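{- Let $V$, $\mathcal Q$, $f_Q$ ($Q\in\mathcal Q$), $c_{si},c_{it}$, the node set $N$, arc set $A'$ and the function $g$ be as in the context, and let $\varphi\in\mathbb R^{A'}$ be a feasible flow for the submodular flow problem (SF) described there, with $z=\partial\varphi\in B(g)$. For distinct $u,v\in N$ define the exchange capacity $\bar c_{uv}=\min\{\bar g(X): u\in X\subseteq N-\{v\}\}$ where $\bar g(X)=g(X)-z(X)$. For $Q\in\mathcal Q$ and distinct $i,j\in Q$ define $\bar c_{Qij}=\min\{f_Q(S)-\varphi_Q(S): i\in S\subseteq Q-\{j\}\}$, where $\varphi_Q\in\mathbb R^Q$ has components $\varphi_{Qi}=\varphi_{i,Qi}$. Then $\bar c_{uv}=\bar c_{Qij}$ if $(u,v)=(Qi,Qj)$ for some $Q\in\mathcal Q$ and distinct $i,j\in Q$, and $\bar c_{uv}=0$ otherwise.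
   Context: $V$ is a finite set, $\mathcal Q$ a finite family of subsets of $V$ each of size at least $2$; each $f_Q:2^Q\to\mathbb R$ is submodular with $\min_{S\subseteq Q} f_Q(S)=f_Q(\varnothing)=f_Q(Q)=0$; $c_{si},c_{it}\ge0$ for $i\in V$. Nodes: $N=\{s,t\}\cup V\cup\bigcup_{Q\in\mathcal Q}Q^\star$, $Q^\star=\{Qi:i\in Q\}$ (disjoint copies). Arcs: $A=\{(i,Qi),(Qi,i): Q\in\mathcal Q, i\in Q\}\cup\{(s,i),(i,s),(i,t),(t,i): i\in V\}$ and $A'=A\cup\{(s,t),(t,s)\}$, with capacities $c_{si},c_{it}$ as given, $c_{is}=c_{ti}=0$, $c_{i,Qi}=c_{Qi,i}=+\infty$, $c_{ts}=+\infty$, $c_{st}=0$; costs $d_{ts}=1$, $d_a=0$ otherwise. For $\varphi\in\mathbb R^{A'}$, $\partial\varphi(u)=\sum_{(v,u)\in A'}\varphi_{vu}$. $g(X)=\sum_{Q\in\mathcal Q}f_Q(\{i\in Q:Qi\in X\})$ for $X\subseteq N$, $B(g)=\{z\in\mathbb R^N: z(X)\le g(X)\ \forall X\subseteq N,\ z(N)=0\}$, with $z(X)=\sum_{x\in X}z_x$. (SF): maximize $\sum_{a\in A'}d_a\varphi_a$ subject to $\varphi_{uv}=-\varphi_{vu}$ for $(u,v)\in A'$, $\varphi_a\le c_a$ for $a\in A'$, and $\partial\varphi\in B(g)$. -}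

module Defs where

open import Data.Nat using (ℕ; zero; suc)
open import Data.Bool using (Bool; true; false; if_then_else_)
open import Data.Fin using (Fin; zero; suc)
open import Data.Vec using (lookup; tabulate)
open import Data.Fin.Subset using (Subset; _∈_; _∉_; _⊆_; _∪_; _∩_)
  renaming (⊥ to ∅)
open import Data.Product using (Σ; _×_)
open import Relation.Binary.PropositionalEquality using (_≡_; refl)
open import Algebra.Structures using (IsAbelianGroup)
open import Relation.Binary.Structures using (IsTotalOrder)

-- A totally ordered abelian group.  The statement is over ℝ; we state it for
-- an arbitrary totally ordered abelian group (ℝ with + and ≤ is an instance).
record OrderedAbelianGroup : Set₁ where
  infix  4 _≤_
  infixl 6 _+_ _-_
  infix  8 -_
  field
    Carrier        : Set
    _≤_            : Carrier → Carrier → Set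
    _+_            : Carrier → Carrier → Carrier
    0#             : Carrier
    -_             : Carrier → Carrier
    isAbelianGroup : IsAbelianGroup _≡_ _+_ 0# -_
    isTotalOrder   : IsTotalOrder _≡_ _≤_
    +-monoˡ-≤      : ∀ {x y} z → x ≤ y → x + z ≤ y + z

  _-_ : Carrier → Carrier → Carrier
  x - y = x + (- y)

-- The network of the context.  V = Fin n, the family 𝒬 is indexed by Fin m,
-- Q k ⊆ V is the k-th member of 𝒬.
module Network (G : OrderedAbelianGroup) {n m : ℕ} (Q : Fin m → Subset n) where
  open OrderedAbelianGroup G

  -- node set N = {s,t} ∪ V ∪ ⋃ Q⋆ ; cpy k i _ is the copy Qi of i ∈ Q
  data Node : Set where
    s t : Node
    vtx : Fin n → Node
    cpy : (k : Fin m) (i : Fin n) → lookup (Q k) i ≡ true → Node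

  data Arc : Set where
    s⇒_ : Fin n → Arc
    _⇒s : Fin n → Arc
    _⇒t : Fin n → Arc
    t⇒_ : Fin n → Arc
    toCpy   : (k : Fin m) (i : Fin n) → lookup (Q k) i ≡ true → Arc
    fromCpy : (k : Fin m) (i : Fin n) → lookup (Q k) i ≡ true → Arc
    s⇒t t⇒s : Arc

  sumFin : ∀ {p} → (Fin p → Carrier) → Carrier
  sumFin {zero}  h = 0#
  sumFin {suc p} h = h zero + sumFin (λ i → h (suc i))

  onTrue : (b : Bool) → (b ≡ true → Carrier) → Carrier
  onTrue true  h = h refl
  onTrue false h = 0#

  selB : (b : Bool) → (b ≡ true → Bool) → Bool
  selB true  h = h refl
  selB false h = false

  sumCopies : (k : Fin m) → ((i : Fin n) → lookup (Q k) i ≡ true → Carrier) → Carrier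
  sumCopies k h = sumFin (λ i → onTrue (lookup (Q k) i) (h i))

  sumN : (Node → Carrier) → Carrier
  sumN h = h s + h t + sumFin (λ i → h (vtx i))
           + sumFin (λ k → sumCopies k (λ i p → h (cpy k i p)))

  NodeSet : Set
  NodeSet = Node → Bool

  _⟨_⟩ : (Node → Carrier) → NodeSet → Carrier
  z ⟨ X ⟩ = sumN (λ x → if X x then z x else 0#)

  restrict : Fin m → NodeSet → Subset n
  restrict k X = tabulate (λ i → selB (lookup (Q k) i) (λ p → X (cpy k i p)))

  -- g(X) = Σ_Q f_Q({i ∈ Q : Qi ∈ X})
  g : (Fin m → Subset n → Carrier) → NodeSet → Carrier
  g F X = sumFin (λ k → F k (restrict k X))

  -- ∂φ(u) = Σ_{(v,u) ∈ A'} φ_vu, written out node by node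
  ∂ : (Arc → Carrier) → Node → Carrier
  ∂ φ s         = sumFin (λ i → φ (i ⇒s)) + φ t⇒s
  ∂ φ t         = sumFin (λ i → φ (i ⇒t)) + φ s⇒t
  ∂ φ (vtx i)   = φ (s⇒ i) + φ (t⇒ i)
                  + sumFin (λ k → onTrue (lookup (Q k) i) (λ p → φ (fromCpy k i p)))
  ∂ φ (cpy k i p) = φ (toCpy k i p)

  InBase : (Fin m → Subset n → Carrier) → (Node → Carrier) → Set
  InBase F z = (∀ X → z ⟨ X ⟩ ≤ g F X) × sumN z ≡ 0#

  -- f : 2^Q → ℝ submodular, for Q = Q k (only subsets of Q k matter)
  SubmodularOn : Fin m → (Subset n → Carrier) → Set
  SubmodularOn k f = ∀ S T → S ⊆ Q k → T ⊆ Q k → f (S ∪ T) + f (S ∩ T) ≤ f S + f T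

  NormalizedOn : Fin m → (Subset n → Carrier) → Set
  NormalizedOn k f = f ∅ ≡ 0# × f (Q k) ≡ 0# × (∀ S → S ⊆ Q k → f ∅ ≤ f S)

  -- feasibility of φ for (SF) except the base-polyhedron condition:
  -- skew-symmetry on A' and capacities (infinite capacities impose nothing)
  Feasible : (cs ct : Fin n → Carrier) → (Arc → Carrier) → Set
  Feasible cs ct φ =
      (∀ i → φ (i ⇒s) ≡ - φ (s⇒ i))
    × (∀ i → φ (t⇒ i) ≡ - φ (i ⇒t))
    × (∀ k i p → φ (fromCpy k i p) ≡ - φ (toCpy k i p))
    × (φ t⇒s ≡ - φ s⇒t)
    × (∀ i → φ (s⇒ i) ≤ cs i) × (∀ i → φ (i ⇒s) ≤ 0#)
    × (∀ i → φ (i ⇒t) ≤ ct i) × (∀ i → φ (t⇒ i) ≤ 0#)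
    × (φ s⇒t ≤ 0#)

  IsMin : {A : Set} → (A → Set) → (A → Carrier) → Carrier → Set
  IsMin {A} P h μ = Σ A (λ a → P a × h a ≡ μ) × (∀ a → P a → μ ≤ h a)

  ExchCap : (Fin m → Subset n → Carrier) → (Arc → Carrier) → Node → Node → Carrier → Set
  ExchCap F φ u v μ =
    IsMin (λ X → X u ≡ true × X v ≡ false) (λ X → g F X - (∂ φ) ⟨ X ⟩) μ

  φQ : Fin m → (Arc → Carrier) → Subset n → Carrier
  φQ k φ S = sumCopies k (λ i p → if lookup S i then φ (toCpy k i p) else 0#)

  LocalCap : (Fin m → Subset n → Carrier) → (Arc → Carrier) → Fin m → Fin n → Fin n → Carrier → Set
  LocalCap F φ k i j μ =
    IsMin (λ S → S ⊆ Q k × i ∈ S × j ∉ S) (λ S → F k S - φQ k φ S) μ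

module Submission where

open import Defs
open import Data.Nat using (ℕ; _≤_)
open import Data.Fin using (Fin)
open import Data.Vec using (lookup)
open import Data.Bool using (true)
open import Data.Fin.Subset using (Subset; ∣_∣)
open import Data.Product using (_×_; ∃-syntax)
open import Relation.Binary.PropositionalEquality using (_≡_; _≢_)
open import Relation.Nullary using (¬_)
open import Function.Bundles using (_⇔_)

open import Data.Nat using (zero; suc)
open import Data.Fin using (zero; suc; punchIn)
open import Data.Fin.Properties using (_≟_; punchInᵢ≢i)
open import Data.Fin.Subset using (_∈_; _∉_; _⊆_) renaming (⊥ to ∅)
open import Data.Fin.Subset.Properties using (∉⊥; ⊆-refl)
open import Data.Bool using (Bool; false; _∧_; not; if_then_else_)
open import Data.Bool.Properties using (∧-identityʳ; ∧-zeroʳ; not-¬; ¬-not)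
import Data.Bool as Bool
open import Data.Vec.Properties
  using (tabulate-cong; tabulate∘lookup; lookup∘tabulate; lookup-replicate; []=⇒lookup; lookup⇒[]=)
open import Data.Vec.Functional using (removeAt)
open import Data.Product using (_,_; proj₁; proj₂)
open import Data.Sum using (_⊎_; inj₁; inj₂)
open import Data.Empty using (⊥-elim)
open import Relation.Nullary using (yes; no; does)
open import Relation.Nullary.Decidable using (dec-true; dec-false)
open import Relation.Binary.PropositionalEquality
  using (refl; sym; trans; cong; subst; subst₂; module ≡-Reasoning)
open import Relation.Binary.Structures using (IsTotalOrder)
open import Algebra.Bundles using (AbelianGroup)
import Algebra.Properties.AbelianGroup as AbelianGroupProperties
import Algebra.Properties.CommutativeSemigroup as CommutativeSemigroupProperties
import Algebra.Properties.CommutativeMonoid.Sum as CommutativeMonoidSum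
open import Axiom.UniquenessOfIdentityProofs using (module Decidable⇒UIP)
open import Function.Bundles using (mk⇔)

-- Write ḡ(X) = g(X) - z(X) with z = ∂φ; the base condition z ∈ B(g) says
-- exactly that ḡ ≥ 0.  Both parts of the proposition rest on two facts.
--
--  * A node set X is "copy-closed" if for every Q it contains either all or
--    none of the copy nodes Q⋆.  For such X every f_Q is evaluated at ∅ or
--    at Q, so g(X) = 0 by normalisation; the same holds for the complement,
--    and z(X) + z(N∖X) = z(N) = 0 with both terms ≤ 0 forces z(X) = 0.
--    Hence ḡ(X) = 0, so ḡ attains its minimum 0 on every copy-closed set.
--  * Locality: ḡ(X) = (f_Q(S) - φ_Q(S)) + ḡ(X ∖ Q⋆), where S = {i : Qi ∈ X}.
--
-- If (u,v) = (Qi,Qj) the locality identity bounds ḡ from below by the local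
-- function f_Q - φ_Q, with equality on sets X ⊆ Q⋆, so both minimisation
-- problems have the same minima.  In every other case (u,v) is separated by
-- a copy-closed set ({u}, N∖{v} or Q⋆), so the exchange capacity is 0.

module OrderedGroupFacts (G : OrderedAbelianGroup) where
  open OrderedAbelianGroup G renaming (_≤_ to _≤G_)
  open IsTotalOrder isTotalOrder using (antisym)
  open ≡-Reasoning

  abelianGroup : AbelianGroup _ _
  abelianGroup = record { isAbelianGroup = isAbelianGroup }

  open AbelianGroup abelianGroup public
    using (comm; identityˡ; identityʳ; inverseʳ; commutativeMonoid) renaming (∙-cong to +-cong)
  open AbelianGroup abelianGroup using (commutativeSemigroup)
  open AbelianGroupProperties abelianGroup using (⁻¹-∙-comm; inverseʳ-unique)
  open CommutativeSemigroupProperties commutativeSemigroup public using (interchange)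

  -‿interchange : ∀ a b c d → (a + b) - (c + d) ≡ (a - c) + (b - d)
  -‿interchange a b c d = begin
    (a + b) + - (c + d)   ≡⟨ cong ((a + b) +_) (sym (⁻¹-∙-comm c d)) ⟩
    (a + b) + (- c + - d) ≡⟨ interchange a b (- c) (- d) ⟩
    (a - c) + (b - d)     ∎

  x≤y⇒0≤y-x : ∀ {a b} → a ≤G b → 0# ≤G b - a
  x≤y⇒0≤y-x {a} {b} a≤b = subst (_≤G b - a) (inverseʳ a) (+-monoˡ-≤ (- a) a≤b)

  x≤x+y : ∀ a {c} → 0# ≤G c → a ≤G a + c
  x≤x+y a {c} 0≤c = subst₂ _≤G_ (identityˡ a) (comm c a) (+-monoˡ-≤ a 0≤c)

  nonpos-sum-zero : ∀ {a b} → a ≤G 0# → b ≤G 0# → a + b ≡ 0# → a ≡ 0#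
  nonpos-sum-zero {a} {b} a≤0 b≤0 a+b≡0 = antisym a≤0 0≤a
    where
      a≡-b : a ≡ - b
      a≡-b = inverseʳ-unique b a (trans (comm b a) a+b≡0)
      0≤a : 0# ≤G a
      0≤a = subst (0# ≤G_) (trans (identityˡ (- b)) (sym a≡-b)) (x≤y⇒0≤y-x b≤0)

module NetworkFacts (G : OrderedAbelianGroup) {n m : ℕ} (Q : Fin m → Subset n) where
  open OrderedAbelianGroup G renaming (_≤_ to _≤G_)
  open IsTotalOrder isTotalOrder using (antisym) renaming (trans to ≤-trans)
  open Network G Q
  open OrderedGroupFacts G
  open CommutativeMonoidSum commutativeMonoid
    using (sum; sum-cong-≗; ∑-distrib-+; sum-remove; sum-replicate-zero)
  open ≡-Reasoning

  sumFin≡sum : ∀ {p} (h : Fin p → Carrier) → sumFin h ≡ sum h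
  sumFin≡sum {zero}  h = refl
  sumFin≡sum {suc p} h = cong (h zero +_) (sumFin≡sum (λ i → h (suc i)))

  sumFin-cong : ∀ {p} {h h' : Fin p → Carrier} → (∀ i → h i ≡ h' i) → sumFin h ≡ sumFin h'
  sumFin-cong {h = h} {h'} h≗h' =
    trans (sumFin≡sum h) (trans (sum-cong-≗ h≗h') (sym (sumFin≡sum h')))

  sumFin-+ : ∀ {p} (a b : Fin p → Carrier) → sumFin (λ i → a i + b i) ≡ sumFin a + sumFin b
  sumFin-+ a b = begin
    sumFin (λ i → a i + b i) ≡⟨ sumFin≡sum (λ i → a i + b i) ⟩
    sum (λ i → a i + b i)    ≡⟨ ∑-distrib-+ a b ⟩
    sum a + sum b            ≡⟨ sym (+-cong (sumFin≡sum a) (sumFin≡sum b)) ⟩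
    sumFin a + sumFin b      ∎

  sumFin-zero : ∀ p → sumFin {p} (λ _ → 0#) ≡ 0#
  sumFin-zero p = trans (sumFin≡sum {p} (λ _ → 0#)) (sum-replicate-zero p)

  sumFin-split : ∀ {p} (h h' : Fin p → Carrier) (k : Fin p) →
    (∀ k' → k' ≢ k → h k' ≡ h' k') → h' k ≡ 0# → sumFin h ≡ h k + sumFin h'
  sumFin-split {suc _} h h' k agree h'k≡0 = begin
    sumFin h                           ≡⟨ sumFin≡sum h ⟩
    sum h                              ≡⟨ sum-remove {i = k} h ⟩
    h k + sum (removeAt h k)           ≡⟨ cong (h k +_) rest ⟩
    h k + (h' k + sum (removeAt h' k)) ≡⟨ cong (h k +_) (sym (sum-remove {i = k} h')) ⟩
    h k + sum h'                       ≡⟨ cong (h k +_) (sym (sumFin≡sum h')) ⟩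
    h k + sumFin h'                    ∎
    where
      rest : sum (removeAt h k) ≡ h' k + sum (removeAt h' k)
      rest = begin
        sum (removeAt h k)          ≡⟨ sum-cong-≗ (λ j → agree (punchIn k j) (punchInᵢ≢i k j)) ⟩
        sum (removeAt h' k)         ≡⟨ sym (identityˡ _) ⟩
        0# + sum (removeAt h' k)    ≡⟨ cong (_+ sum (removeAt h' k)) (sym h'k≡0) ⟩
        h' k + sum (removeAt h' k)  ∎

  onTrue-cong : ∀ b {a c : b ≡ true → Carrier} → (∀ p → a p ≡ c p) → onTrue b a ≡ onTrue b c
  onTrue-cong true  a≗c = a≗c refl
  onTrue-cong false a≗c = refl

  onTrue-+ : ∀ b (a c : b ≡ true → Carrier) → onTrue b (λ p → a p + c p) ≡ onTrue b a + onTrue b c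
  onTrue-+ true  a c = refl
  onTrue-+ false a c = sym (identityˡ 0#)

  sumCopies-cong : ∀ k {a c : (i : Fin n) → lookup (Q k) i ≡ true → Carrier} →
    (∀ i p → a i p ≡ c i p) → sumCopies k a ≡ sumCopies k c
  sumCopies-cong k a≗c = sumFin-cong (λ i → onTrue-cong (lookup (Q k) i) (a≗c i))

  sumCopies-+ : ∀ k (a c : (i : Fin n) → lookup (Q k) i ≡ true → Carrier) →
    sumCopies k (λ i p → a i p + c i p) ≡ sumCopies k a + sumCopies k c
  sumCopies-+ k a c =
    trans (sumFin-cong (λ i → onTrue-+ (lookup (Q k) i) (a i) (c i)))
          (sumFin-+ (λ i → onTrue (lookup (Q k) i) (a i)) (λ i → onTrue (lookup (Q k) i) (c i)))

  sumCopies-zero : ∀ k → sumCopies k (λ _ _ → 0#) ≡ 0#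
  sumCopies-zero k = trans (sumFin-cong (λ i → zeroAt (lookup (Q k) i))) (sumFin-zero n)
    where
      zeroAt : ∀ b → onTrue b (λ _ → 0#) ≡ 0#
      zeroAt true  = refl
      zeroAt false = refl

  sumN-cong : ∀ {a c : Node → Carrier} → (∀ x → a x ≡ c x) → sumN a ≡ sumN c
  sumN-cong a≗c =
    +-cong (+-cong (+-cong (a≗c s) (a≗c t)) (sumFin-cong (λ i → a≗c (vtx i))))
          (sumFin-cong (λ k → sumCopies-cong k (λ i p → a≗c (cpy k i p))))

  sumN-+ : ∀ (a c : Node → Carrier) → sumN (λ x → a x + c x) ≡ sumN a + sumN c
  sumN-+ a c = begin
    sumN (λ x → a x + c x)
      ≡⟨ +-cong (+-cong (interchange _ _ _ _) (sumFin-+ (λ i → a (vtx i)) (λ i → c (vtx i))))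
               (trans (sumFin-cong (λ k → sumCopies-+ k _ _)) (sumFin-+ a⋆ c⋆)) ⟩
    (((a s + a t) + (c s + c t)) + (Aᵥ + Cᵥ)) + (A⋆ + C⋆)
      ≡⟨ cong (_+ (A⋆ + C⋆)) (interchange _ _ _ _) ⟩
    (((a s + a t) + Aᵥ) + ((c s + c t) + Cᵥ)) + (A⋆ + C⋆)
      ≡⟨ interchange _ _ _ _ ⟩
    sumN a + sumN c ∎
    where
      a⋆ c⋆ : Fin m → Carrier
      a⋆ k = sumCopies k (λ i p → a (cpy k i p))
      c⋆ k = sumCopies k (λ i p → c (cpy k i p))
      Aᵥ = sumFin (λ i → a (vtx i))
      Cᵥ = sumFin (λ i → c (vtx i))
      A⋆ = sumFin a⋆
      C⋆ = sumFin c⋆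

  _∩ᴺ_ _∖ᴺ_ : NodeSet → NodeSet → NodeSet
  (X ∩ᴺ Y) x = X x ∧ Y x
  (X ∖ᴺ Y) x = X x ∧ not (Y x)

  ∁ᴺ : NodeSet → NodeSet
  ∁ᴺ X x = not (X x)

  select : Bool → Carrier → Carrier
  select b c = if b then c else 0#

  ⟨⟩-split : ∀ w C X → w ⟨ X ⟩ ≡ w ⟨ C ∩ᴺ X ⟩ + w ⟨ X ∖ᴺ C ⟩
  ⟨⟩-split w C X =
    trans (sumN-cong pointwise)
          (sumN-+ (λ x → select (C x ∧ X x) (w x)) (λ x → select (X x ∧ not (C x)) (w x)))
    where
      pointwise : ∀ x → select (X x) (w x) ≡ select (C x ∧ X x) (w x) + select (X x ∧ not (C x)) (w x)
      pointwise x with C x | X x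
      ... | true  | true  = sym (identityʳ _)
      ... | true  | false = sym (identityˡ _)
      ... | false | true  = sym (identityˡ _)
      ... | false | false = sym (identityˡ _)

  ⟨⟩-complement : ∀ w X → w ⟨ X ⟩ + w ⟨ ∁ᴺ X ⟩ ≡ sumN w
  ⟨⟩-complement w X =
    trans (sym (sumN-+ (λ x → select (X x) (w x)) (λ x → select (not (X x)) (w x)))) (sumN-cong pointwise)
    where
      pointwise : ∀ x → select (X x) (w x) + select (not (X x)) (w x) ≡ w x
      pointwise x with X x
      ... | true  = identityʳ _
      ... | false = identityˡ _

  copies : Fin m → NodeSet
  copies k (cpy k' _ _) = does (k' ≟ k)
  copies k _            = false

  copies-self : ∀ k i p → copies k (cpy k i p) ≡ true
  copies-self k i p = dec-true (k ≟ k) refl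

  copies-other : ∀ {k k'} i p → k' ≢ k → copies k (cpy k' i p) ≡ false
  copies-other {k} {k'} i p k'≢k = dec-false (k' ≟ k) k'≢k

  ⟨⟩-copies : ∀ w k X →
    w ⟨ copies k ∩ᴺ X ⟩ ≡ sumCopies k (λ i p → select (X (cpy k i p)) (w (cpy k i p)))
  ⟨⟩-copies w k X = begin
    ((0# + 0#) + sumFin {n} (λ _ → 0#)) + sumFin H ≡⟨ cong (_+ sumFin H) nonCopies ⟩
    0# + sumFin H                             ≡⟨ identityˡ _ ⟩
    sumFin H                                  ≡⟨ sumFin-split H (λ _ → 0#) k otherBlocks refl ⟩
    H k + sumFin {m} (λ _ → 0#)               ≡⟨ cong (H k +_) (sumFin-zero m) ⟩
    H k + 0#                                  ≡⟨ identityʳ _ ⟩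
    H k                                       ≡⟨ sumCopies-cong k ownBlock ⟩
    sumCopies k (λ i p → select (X (cpy k i p)) (w (cpy k i p))) ∎
    where
      H : Fin m → Carrier
      H k' = sumCopies k' (λ i p → select (copies k (cpy k' i p) ∧ X (cpy k' i p)) (w (cpy k' i p)))
      nonCopies : (0# + 0#) + sumFin {n} (λ _ → 0#) ≡ 0#
      nonCopies = trans (cong ((0# + 0#) +_) (sumFin-zero n)) (trans (identityʳ _) (identityˡ 0#))
      otherBlocks : ∀ k' → k' ≢ k → H k' ≡ 0#
      otherBlocks k' k'≢k = trans (sumCopies-cong k' (λ i p →
          cong (λ b → select (b ∧ X (cpy k' i p)) (w (cpy k' i p))) (copies-other i p k'≢k)))
        (sumCopies-zero k')
      ownBlock : ∀ i p → select (copies k (cpy k i p) ∧ X (cpy k i p)) (w (cpy k i p))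
                       ≡ select (X (cpy k i p)) (w (cpy k i p))
      ownBlock i p = cong (λ b → select (b ∧ X (cpy k i p)) (w (cpy k i p))) (copies-self k i p)

  CopyClosed : NodeSet → Set
  CopyClosed X = ∀ k → (∀ i p → X (cpy k i p) ≡ true) ⊎ (∀ i p → X (cpy k i p) ≡ false)

  ∁-copyClosed : ∀ X → CopyClosed X → CopyClosed (∁ᴺ X)
  ∁-copyClosed X closed k with closed k
  ... | inj₁ full  = inj₂ (λ i p → cong not (full i p))
  ... | inj₂ empty = inj₁ (λ i p → cong not (empty i p))

  copies-copyClosed : ∀ k → CopyClosed (copies k)
  copies-copyClosed k k' with k' ≟ k
  ... | yes _ = inj₁ (λ _ _ → refl)
  ... | no  _ = inj₂ (λ _ _ → refl)

  selB-true : ∀ {b} {h : b ≡ true → Bool} (p : b ≡ true) → selB b h ≡ h p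
  selB-true refl = refl

  lookup-restrict : ∀ k X i (p : lookup (Q k) i ≡ true) → lookup (restrict k X) i ≡ X (cpy k i p)
  lookup-restrict k X i p = trans (lookup∘tabulate _ i) (selB-true p)

  restrict-⊆ : ∀ k X → restrict k X ⊆ Q k
  restrict-⊆ k X {i} i∈R = lookup⇒[]= i (Q k) (inQ (lookup (Q k) i) _ R[i]≡true)
    where
      R[i]≡true : selB (lookup (Q k) i) (λ p → X (cpy k i p)) ≡ true
      R[i]≡true = trans (sym (lookup∘tabulate _ i)) ([]=⇒lookup i∈R)
      inQ : ∀ b (h : b ≡ true → Bool) → selB b h ≡ true → b ≡ true
      inQ true  _ _  = refl
      inQ false _ ()

  restrict-unique : ∀ k X S → S ⊆ Q k → (∀ i p → X (cpy k i p) ≡ lookup S i) → restrict k X ≡ S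
  restrict-unique k X S S⊆Q agree = trans (tabulate-cong entry) (tabulate∘lookup S)
    where
      entry : ∀ i → selB (lookup (Q k) i) (λ p → X (cpy k i p)) ≡ lookup S i
      entry i = decide (lookup (Q k) i) (lookup S i) _ (agree i)
                  (λ Si → []=⇒lookup (S⊆Q (lookup⇒[]= i S Si)))
        where
          decide : ∀ b c (h : b ≡ true → Bool) →
                   (∀ p → h p ≡ c) → (c ≡ true → b ≡ true) → selB b h ≡ c
          decide true  c     h h≡c _   = h≡c refl
          decide false false h _   _   = refl
          decide false true  h _   c⇒b with c⇒b refl
          ... | ()

  restrict-full : ∀ k X → (∀ i p → X (cpy k i p) ≡ true) → restrict k X ≡ Q k
  restrict-full k X full = restrict-unique k X (Q k) ⊆-refl (λ i p → trans (full i p) (sym p))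

  restrict-empty : ∀ k X → (∀ i p → X (cpy k i p) ≡ false) → restrict k X ≡ ∅
  restrict-empty k X empty = restrict-unique k X ∅ (λ i∈∅ → ⊥-elim (∉⊥ i∈∅))
    (λ i p → trans (empty i p) (sym (lookup-replicate i false)))

  lift : Fin m → Subset n → NodeSet
  lift k S (cpy k' i p) = copies k (cpy k' i p) ∧ lookup S i
  lift k S _            = false

  lift-self : ∀ k S i p → lift k S (cpy k i p) ≡ lookup S i
  lift-self k S i p = cong (_∧ lookup S i) (copies-self k i p)

  restrict-lift : ∀ k S → S ⊆ Q k → restrict k (lift k S) ≡ S
  restrict-lift k S S⊆Q = restrict-unique k (lift k S) S S⊆Q (lift-self k S)

  lift-outside : ∀ k S → CopyClosed (lift k S ∖ᴺ copies k)
  lift-outside k S k' = inj₂ (λ i p → disjoint (copies k (cpy k' i p)) (lookup S i))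
    where
      disjoint : ∀ b c → (b ∧ c) ∧ not b ≡ false
      disjoint true  c = ∧-zeroʳ c
      disjoint false c = refl

  -- the singleton {u} of a node that is not a copy (empty for copies)
  point : Node → NodeSet
  point s       s       = true
  point t       t       = true
  point (vtx a) (vtx b) = does (a ≟ b)
  point _       _       = false

  point-vtx : ∀ a → point (vtx a) (vtx a) ≡ true
  point-vtx a = dec-true (a ≟ a) refl

  point-other : ∀ u v → u ≢ v → point u v ≡ false
  point-other s           s           u≢v = ⊥-elim (u≢v refl)
  point-other s           t           _   = refl
  point-other s           (vtx _)     _   = refl
  point-other s           (cpy _ _ _) _   = refl
  point-other t           s           _   = refl
  point-other t           t           u≢v = ⊥-elim (u≢v refl)
  point-other t           (vtx _)     _   = refl
  point-other t           (cpy _ _ _) _   = refl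
  point-other (vtx _)     s           _   = refl
  point-other (vtx _)     t           _   = refl
  point-other (vtx a)     (vtx b)     u≢v = dec-false (a ≟ b) (λ a≡b → u≢v (cong vtx a≡b))
  point-other (vtx _)     (cpy _ _ _) _   = refl
  point-other (cpy _ _ _) _           _   = refl

  point-copyClosed : ∀ u → CopyClosed (point u)
  point-copyClosed u k = inj₂ (λ i p → noCopies u)
    where
      noCopies : ∀ u {k i p} → point u (cpy k i p) ≡ false
      noCopies s           = refl
      noCopies t           = refl
      noCopies (vtx _)     = refl
      noCopies (cpy _ _ _) = refl

  IsMin-transfer : ∀ {A B : Set} {P : A → Set} {P' : B → Set} {h : A → Carrier} {h' : B → Carrier}
    (α : A → B) (β : B → A) → (∀ a → P a → P' (α a)) → (∀ b → P' b → P (β b)) →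
    (∀ a → P a → h' (α a) ≤G h a) → (∀ b → P' b → h (β b) ≡ h' b) →
    ∀ μ → IsMin P h μ ⇔ IsMin P' h' μ
  IsMin-transfer {P = P} {P'} {h} {h'} α β αP βP' below exact μ = mk⇔ to from
    where
      to : IsMin P h μ → IsMin P' h' μ
      to ((a , Pa , ha≡μ) , minimal) =
        (α a , αP a Pa , antisym (subst (_ ≤G_) ha≡μ (below a Pa)) (lower (α a) (αP a Pa))) , lower
        where
          lower : ∀ b → P' b → μ ≤G h' b
          lower b P'b = subst (μ ≤G_) (exact b P'b) (minimal (β b) (βP' b P'b))
      from : IsMin P' h' μ → IsMin P h μ
      from ((b , P'b , h'b≡μ) , minimal) =
        (β b , βP' b P'b , trans (exact b P'b) h'b≡μ) ,
        (λ a Pa → ≤-trans (minimal (α a) (αP a Pa)) (below a Pa))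

  module Capacities (F : Fin m → Subset n → Carrier) (φ : Arc → Carrier)
                    (normalised : ∀ k → NormalizedOn k (F k)) (inBase : InBase F (∂ φ)) where

    z : Node → Carrier
    z = ∂ φ

    ḡ : NodeSet → Carrier
    ḡ X = g F X - z ⟨ X ⟩

    ḡ-nonneg : ∀ X → 0# ≤G ḡ X
    ḡ-nonneg X = x≤y⇒0≤y-x (proj₁ inBase X)

    -- on a copy-closed set each f_Q is evaluated at ∅ or at Q
    g-copyClosed : ∀ X → CopyClosed X → g F X ≡ 0#
    g-copyClosed X closed = trans (sumFin-cong blockValue) (sumFin-zero m)
      where
        blockValue : ∀ k → F k (restrict k X) ≡ 0#
        blockValue k with closed k
        ... | inj₁ full  = trans (cong (F k) (restrict-full k X full)) (proj₁ (proj₂ (normalised k)))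
        ... | inj₂ empty = trans (cong (F k) (restrict-empty k X empty)) (proj₁ (normalised k))

    z-copyClosed : ∀ X → CopyClosed X → z ⟨ X ⟩ ≡ 0#
    z-copyClosed X closed = nonpos-sum-zero (bound X closed) (bound (∁ᴺ X) (∁-copyClosed X closed))
                                (trans (⟨⟩-complement z X) (proj₂ inBase))
      where
        bound : ∀ Y → CopyClosed Y → z ⟨ Y ⟩ ≤G 0#
        bound Y closedY = subst (z ⟨ Y ⟩ ≤G_) (g-copyClosed Y closedY) (proj₁ inBase Y)

    ḡ-copyClosed : ∀ X → CopyClosed X → ḡ X ≡ 0#
    ḡ-copyClosed X closed = begin
      g F X - z ⟨ X ⟩ ≡⟨ +-cong (g-copyClosed X closed) (cong -_ (z-copyClosed X closed)) ⟩
      0# - 0#         ≡⟨ inverseʳ 0# ⟩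
      0#              ∎

    exchCap-zero : ∀ {u v} X → X u ≡ true → X v ≡ false → CopyClosed X → ExchCap F φ u v 0#
    exchCap-zero X Xu Xv closed = (X , (Xu , Xv) , ḡ-copyClosed X closed) , (λ Y _ → ḡ-nonneg Y)

    g-local : ∀ k X → g F X ≡ F k (restrict k X) + g F (X ∖ᴺ copies k)
    g-local k X = sumFin-split _ _ k sameOutside emptyInside
      where
        sameOutside : ∀ k' → k' ≢ k → F k' (restrict k' X) ≡ F k' (restrict k' (X ∖ᴺ copies k))
        sameOutside k' k'≢k = cong (F k') (sym (restrict-unique k' (X ∖ᴺ copies k) (restrict k' X)
          (restrict-⊆ k' X) (λ i p → begin
            X (cpy k' i p) ∧ not (copies k (cpy k' i p))
              ≡⟨ cong (λ b → X (cpy k' i p) ∧ not b) (copies-other i p k'≢k) ⟩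
            X (cpy k' i p) ∧ true                        ≡⟨ ∧-identityʳ _ ⟩
            X (cpy k' i p)                               ≡⟨ sym (lookup-restrict k' X i p) ⟩
            lookup (restrict k' X) i                     ∎)))
        emptyInside : F k (restrict k (X ∖ᴺ copies k)) ≡ 0#
        emptyInside = trans (cong (F k) (restrict-empty k (X ∖ᴺ copies k) (λ i p →
          trans (cong (λ b → X (cpy k i p) ∧ not b) (copies-self k i p)) (∧-zeroʳ _))))
          (proj₁ (normalised k))

    z-local : ∀ k X → z ⟨ X ⟩ ≡ φQ k φ (restrict k X) + z ⟨ X ∖ᴺ copies k ⟩
    z-local k X = trans (⟨⟩-split z (copies k) X) (cong (_+ z ⟨ X ∖ᴺ copies k ⟩) inBlock)
      where
        inBlock : z ⟨ copies k ∩ᴺ X ⟩ ≡ φQ k φ (restrict k X)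
        inBlock = trans (⟨⟩-copies z k X) (sumCopies-cong k (λ i p →
          cong (λ b → select b (φ (toCpy k i p))) (sym (lookup-restrict k X i p))))

    ḡ-local : ∀ k X → ḡ X ≡ (F k (restrict k X) - φQ k φ (restrict k X)) + ḡ (X ∖ᴺ copies k)
    ḡ-local k X = trans (+-cong (g-local k X) (cong -_ (z-local k X)))
                        (-‿interchange _ _ _ _)

    -- off Q⋆ only nonnegative terms remain, so f_Q - φ_Q bounds ḡ from below
    localBound : ∀ k X → F k (restrict k X) - φQ k φ (restrict k X) ≤G ḡ X
    localBound k X = subst (F k (restrict k X) - φQ k φ (restrict k X) ≤G_) (sym (ḡ-local k X))
                           (x≤x+y _ (ḡ-nonneg (X ∖ᴺ copies k)))

    ḡ-lift : ∀ k S → S ⊆ Q k → ḡ (lift k S) ≡ F k S - φQ k φ S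
    ḡ-lift k S S⊆Q = begin
      ḡ (lift k S)
        ≡⟨ ḡ-local k (lift k S) ⟩
      (F k (restrict k (lift k S)) - φQ k φ (restrict k (lift k S))) + ḡ (lift k S ∖ᴺ copies k)
        ≡⟨ +-cong (cong (λ T → F k T - φQ k φ T) (restrict-lift k S S⊆Q))
                  (ḡ-copyClosed (lift k S ∖ᴺ copies k) (lift-outside k S)) ⟩
      (F k S - φQ k φ S) + 0#
        ≡⟨ identityʳ _ ⟩
      F k S - φQ k φ S ∎

    localCapacity : ∀ k i j (pi : lookup (Q k) i ≡ true) (pj : lookup (Q k) j ≡ true) μ →
      ExchCap F φ (cpy k i pi) (cpy k j pj) μ ⇔ LocalCap F φ k i j μ
    localCapacity k i j pi pj = IsMin-transfer (restrict k) (lift k) restrictAdmissible liftAdmissible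
      (λ X _ → localBound k X) (λ S (S⊆Q , _) → ḡ-lift k S S⊆Q)
      where
        restrictAdmissible : ∀ X → X (cpy k i pi) ≡ true × X (cpy k j pj) ≡ false →
          restrict k X ⊆ Q k × i ∈ restrict k X × j ∉ restrict k X
        restrictAdmissible X (Xi , Xj) =
            restrict-⊆ k X
          , lookup⇒[]= i _ (trans (lookup-restrict k X i pi) Xi)
          , λ j∈R → not-¬ (trans (lookup-restrict k X j pj) Xj) ([]=⇒lookup j∈R)
        liftAdmissible : ∀ S → S ⊆ Q k × i ∈ S × j ∉ S →
          lift k S (cpy k i pi) ≡ true × lift k S (cpy k j pj) ≡ false
        liftAdmissible S (_ , i∈S , j∉S) =
            trans (lift-self k S i pi) ([]=⇒lookup i∈S)
          , trans (lift-self k S j pj) (¬-not (λ S[j] → j∉S (lookup⇒[]= j S S[j])))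

    vanishing : ∀ u v → u ≢ v →
      ¬ (∃[ k ] ∃[ i ] ∃[ j ] ∃[ pi ] ∃[ pj ] (i ≢ j × u ≡ cpy k i pi × v ≡ cpy k j pj)) →
      ExchCap F φ u v 0#
    vanishing s       v u≢v _ = exchCap-zero (point s) refl (point-other s v u≢v) (point-copyClosed s)
    vanishing t       v u≢v _ = exchCap-zero (point t) refl (point-other t v u≢v) (point-copyClosed t)
    vanishing (vtx a) v u≢v _ =
      exchCap-zero (point (vtx a)) (point-vtx a) (point-other (vtx a) v u≢v) (point-copyClosed (vtx a))
    vanishing (cpy k i pi) s _ _ =
      exchCap-zero (∁ᴺ (point s)) refl refl (∁-copyClosed (point s) (point-copyClosed s))
    vanishing (cpy k i pi) t _ _ =
      exchCap-zero (∁ᴺ (point t)) refl refl (∁-copyClosed (point t) (point-copyClosed t))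
    vanishing (cpy k i pi) (vtx b) _ _ =
      exchCap-zero (∁ᴺ (point (vtx b))) refl (cong not (point-vtx b))
                   (∁-copyClosed (point (vtx b)) (point-copyClosed (vtx b)))
    vanishing (cpy k i pi) (cpy k' j pj) u≢v notLocal with k' ≟ k | i ≟ j
    ... | no k'≢k | _ =
      exchCap-zero (copies k) (copies-self k i pi) (copies-other j pj k'≢k) (copies-copyClosed k)
    ... | yes refl | no i≢j = ⊥-elim (notLocal (k , i , j , pi , pj , i≢j , refl , refl))
    ... | yes refl | yes refl = ⊥-elim (u≢v (cong (cpy k i) (Decidable⇒UIP.≡-irrelevant Bool._≟_ pi pj)))

-- Only normalisation of the f_Q and the base condition z ∈ B(g) enter the proof.
proposition2 : (G : OrderedAbelianGroup) (n m : ℕ) (Q : Fin m → Subset n) →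
    let open OrderedAbelianGroup G renaming (_≤_ to _≤G_)
        open Network G Q
    in (F : Fin m → Subset n → Carrier) (cs ct : Fin n → Carrier) (φ : Arc → Carrier) →
       (∀ k → 2 ≤ ∣ Q k ∣) →
       (∀ k → SubmodularOn k (F k)) →
       (∀ k → NormalizedOn k (F k)) →
       (∀ i → 0# ≤G cs i) → (∀ i → 0# ≤G ct i) →
       Feasible cs ct φ →
       InBase F (∂ φ) →
       ((k : Fin m) (i j : Fin n) (pi : lookup (Q k) i ≡ true) (pj : lookup (Q k) j ≡ true) →
          i ≢ j → ∀ μ → ExchCap F φ (cpy k i pi) (cpy k j pj) μ ⇔ LocalCap F φ k i j μ)
       × ((u v : Node) → u ≢ v →
          ¬ (∃[ k ] ∃[ i ] ∃[ j ] ∃[ pi ] ∃[ pj ] (i ≢ j × u ≡ cpy k i pi × v ≡ cpy k j pj)) →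
          ExchCap F φ u v 0#)
proposition2 G n m Q F cs ct φ _ _ normalised _ _ _ inBase =
    (λ k i j pi pj _ → localCapacity k i j pi pj)
  , vanishing
  where open NetworkFacts.Capacities G Q F φ normalised inBase
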